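{- Let $\pi = [d_1, \dots, d_n]$ be a non-decreasing sequence of non-negative integers and let its complement sequence be $\bar\pi = [n-1-d_n, n-1-d_{n-1}, \dots, n-1-d_1]$. Then $\pi$ is ds-reconstruction-forcing if and only if $\bar\pi$ is ds-reconstruction-forcing.
   Context: All graphs are finite and simple. For a vertex $v$ of a graph $G$, the card $G-v$ is called ds-completable if, for each integer $d$, the vertices having degree $d$ in $G-v$ are either all neighbours of $v$ in $G$ or all non-neighbours of $v$ in $G$. A graph is ds-reconstructible iff it has at least one ds-completable vertex. A sequence is ds-reconstruction-forcing iff no non-ds-reconstructible graph has that degree sequence (equivalently every graph realizing it is ds-reconstructible; non-graphic sequences are deemed forcing). -}

module Defs where

open import Data.Nat using (ℕ; _≤_; _∸_)
open import Data.Bool using (Bool; true; false; _∧_; not)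
open import Data.Fin using (Fin; _≟_; opposite)
open import Data.Fin.Permutation using (Permutation′; _⟨$⟩ʳ_)
open import Data.Vec using (Vec; lookup; countᵇ; allFin; tabulate)
open import Data.Integer using (ℤ; +_; _-_)
open import Data.Product using (Σ)
open import Data.Sum using (_⊎_)
open import Relation.Nullary using (¬_; does)
open import Relation.Binary.PropositionalEquality using (_≡_)

record Graph (n : ℕ) : Set where
  field
    adj     : Fin n → Fin n → Bool
    symm    : ∀ u v → adj u v ≡ adj v u
    irrefl  : ∀ v → adj v v ≡ false
open Graph public

deg : ∀ {n} → Graph n → Fin n → ℕ
deg G u = countᵇ (λ w → adj G u w) (allFin _)

-- degree of u (u ≠ v) in the card G - v: neighbours w of u with w ≠ v
cardDeg : ∀ {n} → Graph n → Fin n → Fin n → ℕ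
cardDeg G v u = countᵇ (λ w → adj G u w ∧ not (does (w ≟ v))) (allFin _)

DsCompletable : ∀ {n} → Graph n → Fin n → Set
DsCompletable G v =
  ∀ (d : ℕ) →
    (∀ u → ¬ (u ≡ v) → cardDeg G v u ≡ d → adj G v u ≡ true)
    ⊎ (∀ u → ¬ (u ≡ v) → cardDeg G v u ≡ d → adj G v u ≡ false)

DsReconstructible : ∀ {n} → Graph n → Set
DsReconstructible {n} G = Σ (Fin n) (λ v → DsCompletable G v)

Realizes : ∀ {n} → Graph n → Vec ℤ n → Set
Realizes {n} G s =
  Σ (Permutation′ n) (λ σ → ∀ i → + deg G (σ ⟨$⟩ʳ i) ≡ lookup s i)

-- ds-reconstruction-forcing: every graph realizing s is ds-reconstructible
-- (vacuous for non-graphic s).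
DsForcing : ∀ {n} → Vec ℤ n → Set
DsForcing {n} s = ∀ (G : Graph n) → Realizes G s → DsReconstructible G

NonDecreasing : ∀ {n} → Vec ℕ n → Set
NonDecreasing {n} π = ∀ (i j : Fin n) → Data.Fin._≤_ i j → lookup π i ≤ lookup π j

toℤ : ∀ {n} → Vec ℕ n → Vec ℤ n
toℤ π = tabulate (λ i → + lookup π i)

-- complement sequence [n-1-d_n, ..., n-1-d_1] (integer-valued, so entries
-- can be negative when some d_i > n-1, making it non-graphic as in the paper)
complementSeq : ∀ {n} → Vec ℕ n → Vec ℤ n
complementSeq {n} π = tabulate (λ i → + (n ∸ 1) - + lookup π (opposite i))

module Submission where

-- Write Ḡ for the complement of G.  Two counting facts drive the proof:
-- deg G u + deg Ḡ u = n - 1, and, for u ≠ v, the degrees of u in the cards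
-- G - v and Ḡ - v add up to n - 2.  Hence the degree classes of the card
-- Ḡ - v are exactly those of G - v (class d corresponds to class n-2-d),
-- while adjacency to v is negated.  So G - v is ds-completable iff Ḡ - v
-- is, and G is ds-reconstructible iff Ḡ is.
--
-- On the level of sequences, if G realizes s then Ḡ realizes the reversed
-- complement s̄ᵢ = n-1-s_{n-1-i}; this operation is an involution.  So "s is
-- ds-reconstruction-forcing" implies the same for s̄, for every integer
-- sequence s, and the theorem follows by applying this to π and to π̄.

open import Defs
open import Data.Bool using (Bool; true; false; _∧_; not)
open import Data.Bool.Properties using (∧-identityʳ; ∧-zeroʳ; not-involutive)
open import Data.Fin using (Fin; zero; suc; _≟_; opposite)
open import Data.Fin.Properties using (opposite-involutive)
open import Data.Fin.Permutation using (Permutation′; _⟨$⟩ʳ_; permutation; _∘ₚ_)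
open import Data.Integer as ℤ using (ℤ; +_; _-_)
open import Data.Integer.Properties using (pos-+)
open import Data.Integer.Tactic.RingSolver using (solve-∀)
open import Data.Nat using (ℕ; suc; _+_; _∸_)
open import Data.Nat.Properties using (+-comm; +-suc; +-identityʳ; m+n∸m≡n; +-commutativeSemigroup)
open import Algebra.Properties.CommutativeSemigroup +-commutativeSemigroup using (interchange)
open import Data.Product using (_,_)
open import Data.Sum using (inj₁; inj₂)
open import Data.Vec using (Vec; []; _∷_; lookup; countᵇ; allFin; tabulate; map)
open import Data.Vec.Properties using (allFin-map; lookup∘tabulate; tabulate∘lookup; tabulate-cong)
open import Function using (_∘_)
open import Function.Bundles using (_⇔_; mk⇔)
open import Relation.Nullary using (¬_; does; yes; no; contradiction)
open import Relation.Binary.PropositionalEquality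

bit : Bool → ℕ
bit true  = 1
bit false = 0

bit-not : ∀ b → bit b + bit (not b) ≡ 1
bit-not true  = refl
bit-not false = refl

count-cong : ∀ {A : Set} {m} {p q : A → Bool} → (∀ x → p x ≡ q x) →
  (xs : Vec A m) → countᵇ p xs ≡ countᵇ q xs
count-cong eq [] = refl
count-cong {q = q} eq (x ∷ xs) rewrite eq x with q x
... | true  = cong suc (count-cong eq xs)
... | false = count-cong eq xs

count-split : ∀ {A : Set} {m} (p q : A → Bool) (xs : Vec A m) →
  countᵇ p xs ≡ countᵇ (λ x → p x ∧ q x) xs + countᵇ (λ x → p x ∧ not (q x)) xs
count-split p q [] = refl
count-split p q (x ∷ xs) with p x | q x
... | true  | true  = cong suc (count-split p q xs)
... | true  | false = trans (cong suc (count-split p q xs)) (sym (+-suc _ _))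
... | false | _     = count-split p q xs

count-true : ∀ {A : Set} {m} (xs : Vec A m) → countᵇ (λ _ → true) xs ≡ m
count-true []       = refl
count-true (x ∷ xs) = cong suc (count-true xs)

count-false : ∀ {A : Set} {m} {p : A → Bool} → (∀ x → p x ≡ false) →
  (xs : Vec A m) → countᵇ p xs ≡ 0
count-false none []       = refl
count-false none (x ∷ xs) rewrite none x = count-false none xs

count-∷ : ∀ {A : Set} {m} (p : A → Bool) (x : A) (xs : Vec A m) →
  countᵇ p (x ∷ xs) ≡ bit (p x) + countᵇ p xs
count-∷ p x xs with p x
... | true  = refl
... | false = refl

count-map : ∀ {A B : Set} {m} (p : B → Bool) (f : A → B) (xs : Vec A m) →
  countᵇ p (map f xs) ≡ countᵇ (p ∘ f) xs
count-map p f [] = refl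
count-map p f (x ∷ xs) with p (f x)
... | true  = cong suc (count-map p f xs)
... | false = count-map p f xs

count-allFin-suc : ∀ {n} (p : Fin (suc n) → Bool) →
  countᵇ p (allFin (suc n)) ≡ bit (p zero) + countᵇ (p ∘ suc) (allFin n)
count-allFin-suc {n} p = begin
  countᵇ p (allFin (suc n))            ≡⟨ cong (countᵇ p) (allFin-map n) ⟩
  countᵇ p (zero ∷ map suc (allFin n)) ≡⟨ count-∷ p zero (map suc (allFin n)) ⟩
  bit (p zero) + countᵇ p (map suc (allFin n))
    ≡⟨ cong (λ k → bit (p zero) + k) (count-map p suc (allFin n)) ⟩
  bit (p zero) + countᵇ (p ∘ suc) (allFin n) ∎
  where open ≡-Reasoning

count-single : ∀ {n} (p : Fin n → Bool) (v : Fin n) →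
  countᵇ (λ w → p w ∧ does (w ≟ v)) (allFin n) ≡ bit (p v)
count-single {suc n} p zero = begin
  countᵇ (λ w → p w ∧ does (w ≟ zero)) (allFin (suc n))
    ≡⟨ count-allFin-suc (λ w → p w ∧ does (w ≟ zero)) ⟩
  bit (p zero ∧ true) + countᵇ (λ w → p (suc w) ∧ false) (allFin n)
    ≡⟨ cong₂ _+_ (cong bit (∧-identityʳ (p zero))) (count-false (∧-zeroʳ ∘ p ∘ suc) (allFin n)) ⟩
  bit (p zero) + 0
    ≡⟨ +-identityʳ _ ⟩
  bit (p zero) ∎
  where open ≡-Reasoning
count-single {suc n} p (suc v) = begin
  countᵇ (λ w → p w ∧ does (w ≟ suc v)) (allFin (suc n))
    ≡⟨ count-allFin-suc (λ w → p w ∧ does (w ≟ suc v)) ⟩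
  bit (p zero ∧ false) + countᵇ (λ w → p (suc w) ∧ does (w ≟ v)) (allFin n)
    ≡⟨ cong₂ _+_ (cong bit (∧-zeroʳ (p zero))) (count-single (p ∘ suc) v) ⟩
  bit (p (suc v)) ∎
  where open ≡-Reasoning

record Complement {n} (G H : Graph n) : Set where
  constructor negates
  field
    negated : ∀ (u w : Fin n) → ¬ u ≡ w → adj H u w ≡ not (adj G u w)
open Complement

complement-sym : ∀ {n} {G H : Graph n} → Complement G H → Complement H G
complement-sym {G = G} {H} c = negates λ u w u≢w → begin
  adj G u w             ≡⟨ not-involutive (adj G u w) ⟨
  not (not (adj G u w)) ≡⟨ cong not (negated c u w u≢w) ⟨
  not (adj H u w)       ∎
  where open ≡-Reasoning

adj-complement : ∀ {n} {G H : Graph n} → Complement G H → ∀ {u w b} →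
  ¬ u ≡ w → adj G u w ≡ b → adj H u w ≡ not b
adj-complement c {u} {w} u≢w refl = negated c u w u≢w

does-sym : ∀ {n} (u w : Fin n) → does (u ≟ w) ≡ does (w ≟ u)
does-sym u w with u ≟ w | w ≟ u
... | yes _   | yes _   = refl
... | no _    | no _    = refl
... | yes u≡w | no w≢u  = contradiction (sym u≡w) w≢u
... | no u≢w  | yes w≡u = contradiction (sym w≡u) u≢w

complement : ∀ {n} → Graph n → Graph n
complement G = record
  { adj    = λ u w → not (adj G u w) ∧ not (does (u ≟ w))
  ; symm   = λ u w → cong₂ (λ a b → not a ∧ not b) (symm G u w) (does-sym u w)
  ; irrefl = λ u → trans (cong (λ b → not (adj G u u) ∧ not b) (does-refl u)) (∧-zeroʳ _)
  }
  where
  does-refl : ∀ u → does (u ≟ u) ≡ true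
  does-refl u with u ≟ u
  ... | yes _   = refl
  ... | no u≢u = contradiction refl u≢u

complement-isComplement : ∀ {n} (G : Graph n) → Complement G (complement G)
complement-isComplement G = negates off-diagonal
  where
  off-diagonal : ∀ u w → ¬ u ≡ w → adj (complement G) u w ≡ not (adj G u w)
  off-diagonal u w u≢w with u ≟ w
  ... | yes u≡w = contradiction u≡w u≢w
  ... | no _    = ∧-identityʳ _

-- Degree complementarity: deg G u + deg H u = n - 1.
-- Split all n vertices into u itself and the others, and the others into
-- neighbours of u in G and neighbours of u in H.
deg-complement : ∀ {n} {G H : Graph n} → Complement G H → ∀ u →
  suc (deg G u + deg H u) ≡ n
deg-complement {n} {G} {H} c u = sym (begin
  n
    ≡⟨ count-true (allFin n) ⟨
  countᵇ (λ _ → true) (allFin n)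
    ≡⟨ count-split (λ _ → true) isU (allFin n) ⟩
  countᵇ isU (allFin n) + countᵇ (not ∘ isU) (allFin n)
    ≡⟨ cong₂ _+_ (count-single (λ _ → true) u) (count-split (not ∘ isU) (adj G u) (allFin n)) ⟩
  1 + (countᵇ (λ w → not (isU w) ∧ adj G u w) (allFin n)
       + countᵇ (λ w → not (isU w) ∧ not (adj G u w)) (allFin n))
    ≡⟨ cong suc (cong₂ _+_ (count-cong inG (allFin n)) (count-cong inH (allFin n))) ⟩
  suc (deg G u + deg H u) ∎)
  where
  open ≡-Reasoning
  isU : Fin n → Bool
  isU w = does (w ≟ u)
  inG : ∀ w → not (isU w) ∧ adj G u w ≡ adj G u w
  inG w with w ≟ u
  ... | yes refl = sym (irrefl G u)
  ... | no _     = refl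
  inH : ∀ w → not (isU w) ∧ not (adj G u w) ≡ adj H u w
  inH w with w ≟ u
  ... | yes refl = sym (irrefl H u)
  ... | no w≢u   = sym (negated c u w (w≢u ∘ sym))

deg-card : ∀ {n} (G : Graph n) (v u : Fin n) →
  deg G u ≡ bit (adj G u v) + cardDeg G v u
deg-card G v u = trans (count-split (adj G u) (λ w → does (w ≟ v)) (allFin _))
                       (cong (_+ cardDeg G v u) (count-single (adj G u) v))

card-complement : ∀ {n} {G H : Graph n} → Complement G H → ∀ {v u} → ¬ u ≡ v →
  2 + (cardDeg G v u + cardDeg H v u) ≡ n
card-complement {n} {G} {H} c {v} {u} u≢v = begin
  2 + (cardDeg G v u + cardDeg H v u)
    ≡⟨ cong (λ k → suc (k + (cardDeg G v u + cardDeg H v u))) (bit-not (adj G u v)) ⟨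
  suc ((bit (adj G u v) + bit (not (adj G u v))) + (cardDeg G v u + cardDeg H v u))
    ≡⟨ cong suc (interchange (bit (adj G u v)) (cardDeg G v u) (bit (not (adj G u v))) (cardDeg H v u)) ⟨
  suc ((bit (adj G u v) + cardDeg G v u) + (bit (not (adj G u v)) + cardDeg H v u))
    ≡⟨ cong (λ b → suc ((bit (adj G u v) + cardDeg G v u) + (bit b + cardDeg H v u))) (negated c u v u≢v) ⟨
  suc ((bit (adj G u v) + cardDeg G v u) + (bit (adj H u v) + cardDeg H v u))
    ≡⟨ cong suc (cong₂ _+_ (deg-card G v u) (deg-card H v u)) ⟨
  suc (deg G u + deg H u)
    ≡⟨ deg-complement c u ⟩
  n ∎
  where open ≡-Reasoning

card-determined : ∀ {n} {G H : Graph n} → Complement G H → ∀ {v u d} → ¬ u ≡ v →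
  cardDeg H v u ≡ d → cardDeg G v u ≡ n ∸ (2 + d)
card-determined {n} {G} {H} c {v} {u} u≢v refl = begin
  cardDeg G v u
    ≡⟨ m+n∸m≡n (2 + cardDeg H v u) (cardDeg G v u) ⟨
  (2 + cardDeg H v u) + cardDeg G v u ∸ (2 + cardDeg H v u)
    ≡⟨ cong (λ k → 2 + k ∸ (2 + cardDeg H v u)) (+-comm (cardDeg H v u) (cardDeg G v u)) ⟩
  2 + (cardDeg G v u + cardDeg H v u) ∸ (2 + cardDeg H v u)
    ≡⟨ cong (_∸ (2 + cardDeg H v u)) (card-complement c u≢v) ⟩
  n ∸ (2 + cardDeg H v u) ∎
  where open ≡-Reasoning

-- The degree class d of H - v is the degree class n-2-d of G - v, with
-- adjacency to v negated; so ds-completability passes to the complement.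
completable-complement : ∀ {n} {G H : Graph n} → Complement G H → ∀ {v} →
  DsCompletable G v → DsCompletable H v
completable-complement {n} c {v} completable d with completable (n ∸ (2 + d))
... | inj₁ adjacent    = inj₂ λ u u≢v eq →
        adj-complement c (u≢v ∘ sym) (adjacent u u≢v (card-determined c u≢v eq))
... | inj₂ nonadjacent = inj₁ λ u u≢v eq →
        adj-complement c (u≢v ∘ sym) (nonadjacent u u≢v (card-determined c u≢v eq))

reconstructible-complement : ∀ {n} {G H : Graph n} → Complement G H →
  DsReconstructible G → DsReconstructible H
reconstructible-complement c (v , completable) = v , completable-complement c completable

complementℤ : ∀ {n} → Vec ℤ n → Vec ℤ n
complementℤ {n} s = tabulate (λ i → + (n ∸ 1) - lookup s (opposite i))

complementℤ-involutive : ∀ {n} (s : Vec ℤ n) → complementℤ (complementℤ s) ≡ s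
complementℤ-involutive {n} s = trans (tabulate-cong entry) (tabulate∘lookup s)
  where
  x-[x-y]≡y : ∀ (x y : ℤ) → x - (x - y) ≡ y
  x-[x-y]≡y = solve-∀
  entry : ∀ i → + (n ∸ 1) - lookup (complementℤ s) (opposite i) ≡ lookup s i
  entry i = begin
    + (n ∸ 1) - lookup (complementℤ s) (opposite i)
      ≡⟨ cong (+ (n ∸ 1) -_) (lookup∘tabulate (λ j → + (n ∸ 1) - lookup s (opposite j)) (opposite i)) ⟩
    + (n ∸ 1) - (+ (n ∸ 1) - lookup s (opposite (opposite i)))
      ≡⟨ x-[x-y]≡y (+ (n ∸ 1)) (lookup s (opposite (opposite i))) ⟩
    lookup s (opposite (opposite i))
      ≡⟨ cong (lookup s) (opposite-involutive i) ⟩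
    lookup s i ∎
    where open ≡-Reasoning

complementℤ-toℤ : ∀ {n} (π : Vec ℕ n) → complementℤ (toℤ π) ≡ complementSeq π
complementℤ-toℤ {n} π = tabulate-cong λ i →
  cong (+ (n ∸ 1) -_) (lookup∘tabulate (λ j → + lookup π j) (opposite i))

reversal : ∀ {n} → Permutation′ n
reversal = permutation opposite opposite opposite-involutive opposite-involutive

realizes-complement : ∀ {n} {G H : Graph n} {s : Vec ℤ n} → Complement G H →
  Realizes G s → Realizes H (complementℤ s)
realizes-complement {n} {G} {H} {s} c (σ , realizes) = reversal ∘ₚ σ , λ i →
  let w = σ ⟨$⟩ʳ opposite i in begin
  + deg H w
    ≡⟨ x+y-x≡y (+ deg G w) (+ deg H w) ⟨
  + deg G w ℤ.+ + deg H w - + deg G w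
    ≡⟨ cong₂ _-_ (sym (pos-+ (deg G w) (deg H w))) (realizes (opposite i)) ⟩
  + (deg G w + deg H w) - lookup s (opposite i)
    ≡⟨ cong (λ m → + (m ∸ 1) - lookup s (opposite i)) (deg-complement c w) ⟩
  + (n ∸ 1) - lookup s (opposite i)
    ≡⟨ lookup∘tabulate (λ j → + (n ∸ 1) - lookup s (opposite j)) i ⟨
  lookup (complementℤ s) i ∎
  where
  open ≡-Reasoning
  x+y-x≡y : ∀ (x y : ℤ) → x ℤ.+ y - x ≡ y
  x+y-x≡y = solve-∀

-- Forcing is preserved by complementing a sequence: a graph realizing s̄
-- has a complement realizing s, which is reconstructible, hence so is it.
forcing-complement : ∀ {n} (s : Vec ℤ n) → DsForcing s → DsForcing (complementℤ s)
forcing-complement s forcing G realizes =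
  reconstructible-complement (complement-sym isComplement)
    (forcing (complement G)
      (subst (Realizes (complement G)) (complementℤ-involutive s)
        (realizes-complement {s = complementℤ s} isComplement realizes)))
  where
  isComplement : Complement G (complement G)
  isComplement = complement-isComplement G

mainTheorem3 : (n : ℕ) (π : Vec ℕ n) → NonDecreasing π →
    DsForcing (toℤ π) ⇔ DsForcing (complementSeq π)
mainTheorem3 n π _ = mk⇔
  (λ forcing → subst DsForcing (complementℤ-toℤ π) (forcing-complement (toℤ π) forcing))
  (λ forcing → subst DsForcing (complementℤ-involutive (toℤ π))
                 (forcing-complement (complementℤ (toℤ π)) (subst DsForcing (sym (complementℤ-toℤ π)) forcing)))
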